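{- Let $k\ge 1$ and let $G_1,\ldots,G_l$ be $k$-symmetric graphs. Let $G=G_1\vee_k\cdots\vee_k G_l$ be a $k$-symmetric join of $G_1,\ldots,G_l$ (for any choice of $k$-symmetric automorphisms $\varphi_i$ of $G_i$ and bases $B_i$ of $\varphi_i$), and let $n=|V(G)|/k$. Then $m_G(n)\ge l-1$.
   Context: A finite simple graph $G$ is $k$-symmetric if $\mathrm{Aut}(G)$ contains a subgroup isomorphic to $\mathbb{Z}_k$ acting freely on $V(G)$; a generator $\varphi$ of such a subgroup is a $k$-symmetric automorphism. A base of $\varphi$ is a minimal subset $B\subseteq V(G)$ with $\bigcup_{i=0}^{k-1}\varphi^i(B)=V(G)$ (i.e. a set containing exactly one vertex from each orbit), so $|B|=|V(G)|/k$. The $k$-symmetric join $G_1\vee_k\cdots\vee_k G_l$, given $k$-symmetric automorphisms $\varphi_i$ of $G_i$ with chosen bases $B_i$, is the graph obtained from the disjoint union $G_1\cup\cdots\cup G_l$ by adding, for every $j\in\mathbb{Z}_k$ and every pair $i\ne i'$, all edges between vertices of $\varphi_i^j(B_i)$ and vertices of $\varphi_{i'}^j(B_{i'})$. The Laplacian matrix is $L(G)=D(G)-A(G)$ and $m_G(\lambda)$ is the multiplicity of $\lambda$ as an eigenvalue of $L(G)$. -}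

module Defs where

open import Data.Nat as ℕ using (ℕ; zero; suc; _<_; NonZero)
open import Data.Nat.DivMod using (_/_)
open import Data.Integer using (+_)
open import Data.Rational as ℚ using (ℚ; 0ℚ; 1ℚ)
open import Data.Fin using (Fin; toℕ; _≟_)
open import Data.Fin.Properties using (any?)
open import Data.Bool using (Bool; true; false; if_then_else_)
open import Data.Bool.Properties using () renaming (_≟_ to _≟ᵇ_)
open import Data.Product using (Σ; ∃; _×_; _,_)
open import Relation.Nullary using (¬_; yes; no)
open import Relation.Nullary.Decidable using (⌊_⌋; _×-dec_)
open import Relation.Binary.PropositionalEquality using (_≡_; _≢_; refl)

iter : ∀ {A : Set} → ℕ → (A → A) → A → A
iter zero    f x = x
iter (suc i) f x = f (iter i f x)

sumℚ : (n : ℕ) → (Fin n → ℚ) → ℚ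
sumℚ zero    f = 0ℚ
sumℚ (suc n) f = f Fin.zero ℚ.+ sumℚ n (λ i → f (Fin.suc i))
  where import Data.Fin as Fin

sumℕ : (n : ℕ) → (Fin n → ℕ) → ℕ
sumℕ zero    f = 0
sumℕ (suc n) f = f Fin.zero ℕ.+ sumℕ n (λ i → f (Fin.suc i))
  where import Data.Fin as Fin

record Graph : Set where
  field
    N        : ℕ
    nonempty : 0 < N
    adj      : Fin N → Fin N → Bool
    symm     : ∀ u v → adj u v ≡ adj v u
    irrefl   : ∀ v → adj v v ≡ false
open Graph public

-- φ is a k-symmetric automorphism of G: an automorphism generating a subgroup
-- of Aut(G) isomorphic to ℤ_k (φ^k = id and φ^i ≠ id for 0<i<k) acting freely.
record KSymAut (k : ℕ) (G : Graph) : Set where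
  field
    φ      : Fin (N G) → Fin (N G)
    aut    : ∀ u v → adj G (φ u) (φ v) ≡ adj G u v
    period : ∀ v → iter k φ v ≡ v
    order  : ∀ i → 0 < i → i < k → ∃ λ v → iter i φ v ≢ v
    free   : ∀ i → 0 < i → i < k → ∀ v → iter i φ v ≢ v
open KSymAut public

Covers : ∀ {k G} → KSymAut k G → (Fin (N G) → Bool) → Set
Covers {k} {G} f S = ∀ v → Σ ℕ λ i → i < k × ∃ λ b → S b ≡ true × iter i (φ f) b ≡ v

record Base {k G} (f : KSymAut k G) : Set where
  field
    B       : Fin (N G) → Bool
    covers  : Covers f B
    minimal : ∀ (B' : Fin (N G) → Bool) → (∀ b → B' b ≡ true → B b ≡ true) →
              Covers f B' → ∀ b → B b ≡ true → B' b ≡ true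
open Base public

module Join {l k : ℕ} (G : Fin l → Graph) (f : ∀ i → KSymAut k (G i))
            (β : ∀ i → Base (f i)) where

  V : Set
  V = Σ (Fin l) (λ i → Fin (N (G i)))

  sumV : (V → ℚ) → ℚ
  sumV x = sumℚ l (λ i → sumℚ (N (G i)) (λ a → x (i , a)))

  inTr : ∀ i → Fin k → Fin (N (G i)) → Bool
  inTr i j a = ⌊ any? (λ b → (B (β i) b ≟ᵇ true) ×-dec (iter (toℕ j) (φ (f i)) b ≟ a)) ⌋

  joinAdj : V → V → Bool
  joinAdj (i , a) (i' , a') with i ≟ i'
  ... | yes refl = adj (G i) a a'
  ... | no _     = ⌊ any? (λ j → (inTr i j a ≟ᵇ true) ×-dec (inTr i' j a' ≟ᵇ true)) ⌋

  size : ℕ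
  size = sumℕ l (λ i → N (G i))

-- Laplacian L = D - A acting on x : V → ℚ:  (Lx)(v) = Σ_u A(v,u) (x v - x u)
laplacian : {V : Set} → ((V → ℚ) → ℚ) → (V → V → Bool) → (V → ℚ) → V → ℚ
laplacian sumV adj x v = sumV (λ u → (if adj v u then 1ℚ else 0ℚ) ℚ.* (x v ℚ.- x u))

MultAtLeast : {V : Set} → ((V → ℚ) → ℚ) → (V → V → Bool) → ℚ → ℕ → Set
MultAtLeast {V} sumV adj λ' d =
  Σ (Fin d → V → ℚ) λ w →
    (∀ t v → laplacian sumV adj (w t) v ≡ λ' ℚ.* w t v) ×
    (∀ (c : Fin d → ℚ) → (∀ v → sumℚ d (λ t → c t ℚ.* w t v) ≡ 0ℚ) → ∀ t → c t ≡ 0ℚ)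

ℕtoℚ : ℕ → ℚ
ℕtoℚ m = + m ℚ./ 1

-- Each vertex of G_i lies in exactly one translate φ_i^j(B_i), and by minimality of B_i every translate
-- has |B_i| elements, so |V(G_i)| = k|B_i| and n = Σ_i |B_i|.  A vertex of G_i in translate j is joined,
-- inside G_{i'} (i' ≠ i), to exactly the |B_{i'}| vertices of φ_{i'}^j(B_{i'}).  Hence a vector equal to
-- c_i on G_i satisfies (Lx)(v) = Σ_{i'} |B_{i'}| (c_i - c_{i'}) = n c_i whenever Σ_i |B_i| c_i = 0, and
-- that hyperplane of ℚ^l has dimension l - 1.
module Submission where

open import Defs
open import Algebra.Bundles using (CommutativeMonoid; CommutativeRing)
import Algebra.Properties.CommutativeMonoid.Sum as MonoidSum
import Algebra.Properties.Semiring.Sum as SemiringSum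
open import Data.Bool using (Bool; true; false; if_then_else_; _∧_; not)
open import Data.Bool.Properties using () renaming (_≟_ to _≟ᵇ_)
open import Data.Fin as Fin using (Fin; toℕ; fromℕ<; _≟_; punchIn)
import Data.Fin.Permutation as Perm
open import Data.Fin.Properties using (any?; toℕ-injective; toℕ-fromℕ<; toℕ<n; punchInᵢ≢i)
import Data.Integer as ℤ
import Data.Integer.Properties as ℤP
import Data.Integer.Solver
open import Data.Nat as ℕ using (ℕ; zero; suc; NonZero; _∸_; _<_; _≤_)
open import Data.Nat.DivMod using (_/_; _%_; m*n/n≡m; m≡m%n+[m/n]*n; m%n<n)
import Data.Nat.Properties as ℕP
open import Data.Product using (∃; _×_; _,_; proj₁; proj₂)
open import Data.Rational as ℚ using (ℚ; 0ℚ; 1ℚ; _+_; _*_; -_; _-_; 1/_)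
import Data.Rational.Properties as ℚP
import Data.Rational.Solver
import Data.Rational.Unnormalised as ℚᵘ
import Data.Rational.Unnormalised.Properties as ℚᵘP
open import Data.Vec.Functional using (Vector)
open import Relation.Binary.PropositionalEquality using (_≡_; _≢_; refl; sym; trans; cong; cong₂; subst; module ≡-Reasoning)
open import Relation.Binary.Definitions using (tri<; tri≈; tri>)
open import Relation.Nullary using (Dec; yes; no; contradiction)
open import Relation.Nullary.Decidable using (⌊_⌋; _×-dec_; isYes≗does; dec-true)

isYes⇒ : ∀ {A : Set} (a? : Dec A) → ⌊ a? ⌋ ≡ true → A
isYes⇒ (yes a) _ = a

⇒isYes : ∀ {A : Set} (a? : Dec A) → A → ⌊ a? ⌋ ≡ true
⇒isYes a? a = trans (isYes≗does a?) (dec-true a? a)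

isYes-≡ : ∀ {A : Set} (a? : Dec A) {b : Bool} → (A → b ≡ true) → (b ≡ true → A) → ⌊ a? ⌋ ≡ b
isYes-≡ (yes a) {true}  _ _ = refl
isYes-≡ (yes a) {false} A⇒b _ with () ← A⇒b a
isYes-≡ (no ¬a) {true}  _ b⇒A = contradiction (b⇒A refl) ¬a
isYes-≡ (no ¬a) {false} _ _ = refl

fromℚᵘ-homo-+ : ∀ p q → ℚ.fromℚᵘ (p ℚᵘ.+ q) ≡ ℚ.fromℚᵘ p + ℚ.fromℚᵘ q
fromℚᵘ-homo-+ p q = ℚP.toℚᵘ-injective {ℚ.fromℚᵘ (p ℚᵘ.+ q)} {ℚ.fromℚᵘ p + ℚ.fromℚᵘ q} (begin
    ℚ.toℚᵘ (ℚ.fromℚᵘ (p ℚᵘ.+ q))                  ≈⟨ ℚP.toℚᵘ-fromℚᵘ _ ⟩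
    p ℚᵘ.+ q                                        ≈⟨ ℚᵘP.+-cong (ℚᵘP.≃-sym (ℚP.toℚᵘ-fromℚᵘ p)) (ℚᵘP.≃-sym (ℚP.toℚᵘ-fromℚᵘ q)) ⟩
    ℚ.toℚᵘ (ℚ.fromℚᵘ p) ℚᵘ.+ ℚ.toℚᵘ (ℚ.fromℚᵘ q)  ≈⟨ ℚᵘP.≃-sym (ℚP.toℚᵘ-homo-+ (ℚ.fromℚᵘ p) (ℚ.fromℚᵘ q)) ⟩
    ℚ.toℚᵘ (ℚ.fromℚᵘ p + ℚ.fromℚᵘ q)              ∎)
  where open ℚᵘP.≃-Reasoning

ℕtoℚ-+ : ∀ m n → ℕtoℚ (m ℕ.+ n) ≡ ℕtoℚ m + ℕtoℚ n
ℕtoℚ-+ m n = trans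
    (ℚP.fromℚᵘ-cong {ℚᵘ.mkℚᵘ (ℤ.+ (m ℕ.+ n)) 0} {ℚᵘ.mkℚᵘ (ℤ.+ m) 0 ℚᵘ.+ ℚᵘ.mkℚᵘ (ℤ.+ n) 0} (ℚᵘ.*≡* numerators))
    (fromℚᵘ-homo-+ (ℚᵘ.mkℚᵘ (ℤ.+ m) 0) (ℚᵘ.mkℚᵘ (ℤ.+ n) 0))
  where
  open Data.Integer.Solver.+-*-Solver
  numerators : ℤ.+ (m ℕ.+ n) ℤ.* ℤ.+ 1 ≡ (ℤ.+ m ℤ.* ℤ.+ 1 ℤ.+ ℤ.+ n ℤ.* ℤ.+ 1) ℤ.* ℤ.+ 1
  numerators = trans (cong (ℤ._* ℤ.+ 1) (ℤP.pos-+ m n))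
    (solve 2 (λ a b → (a :+ b) :* con (ℤ.+ 1) := (a :* con (ℤ.+ 1) :+ b :* con (ℤ.+ 1)) :* con (ℤ.+ 1))
       refl (ℤ.+ m) (ℤ.+ n))

ℕtoℚ-suc≢0 : ∀ m → ℕtoℚ (suc m) ≢ 0ℚ
ℕtoℚ-suc≢0 m eq with ℚP.fromℚᵘ-injective {ℚᵘ.mkℚᵘ (ℤ.+ suc m) 0} {ℚᵘ.0ℚᵘ} eq
... | ℚᵘ.*≡* ()

indicator : Bool → ℕ
indicator b = if b then 1 else 0

count : ∀ {n} → (Fin n → Bool) → ℕ
count {n} p = sumℕ n (λ j → indicator (p j))

ℕtoℚ-indicator : ∀ b → (if b then 1ℚ else 0ℚ) ≡ ℕtoℚ (indicator b)
ℕtoℚ-indicator true  = refl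
ℕtoℚ-indicator false = refl

ℕtoℚ-sumℕ : ∀ n (g : Fin n → ℕ) → ℕtoℚ (sumℕ n g) ≡ sumℚ n (λ i → ℕtoℚ (g i))
ℕtoℚ-sumℕ zero    g = refl
ℕtoℚ-sumℕ (suc n) g = trans (ℕtoℚ-+ (g Fin.zero) _) (cong (ℕtoℚ (g Fin.zero) +_) (ℕtoℚ-sumℕ n (λ i → g (Fin.suc i))))

x*q≡0⇒x≡0 : ∀ x q → q ≢ 0ℚ → x * q ≡ 0ℚ → x ≡ 0ℚ
x*q≡0⇒x≡0 x q q≢0 xq≡0 = begin
    x              ≡⟨ sym (ℚP.*-identityʳ x) ⟩
    x * 1ℚ         ≡⟨ cong (x *_) (sym (ℚP.*-inverseʳ q)) ⟩
    x * (q * 1/ q) ≡⟨ sym (ℚP.*-assoc x q (1/ q)) ⟩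
    (x * q) * 1/ q ≡⟨ cong (_* 1/ q) xq≡0 ⟩
    0ℚ * 1/ q      ≡⟨ ℚP.*-zeroˡ (1/ q) ⟩
    0ℚ             ∎
  where
  open ≡-Reasoning
  instance _ = ℚ.≢-nonZero q≢0

-- Finite sums

module _ {c ℓ} (M : CommutativeMonoid c ℓ) where
  open CommutativeMonoid M
  open MonoidSum M using (sum; sum-remove; sum-cong-≋; sum-replicate-zero)
  open import Relation.Binary.Reasoning.Setoid setoid

  sum-δ : ∀ {n} (h : Vector Carrier n) p → (∀ s → s ≢ p → h s ≈ ε) → sum h ≈ h p
  sum-δ {suc n} h p vanishes = begin
    sum h                                ≈⟨ sum-remove {i = p} h ⟩
    h p ∙ sum (λ s → h (punchIn p s))    ≈⟨ ∙-congˡ (sum-cong-≋ (λ s → vanishes _ (punchInᵢ≢i p s))) ⟩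
    h p ∙ sum {n} (λ _ → ε)              ≈⟨ ∙-congˡ (sum-replicate-zero n) ⟩
    h p ∙ ε                              ≈⟨ identityʳ (h p) ⟩
    h p                                  ∎

module ℚΣ = SemiringSum (CommutativeRing.semiring ℚP.+-*-commutativeRing)
module ℕΣ = SemiringSum ℕP.+-*-semiring

sumℚ≡sum : ∀ n (f : Fin n → ℚ) → sumℚ n f ≡ ℚΣ.sum f
sumℚ≡sum zero    f = refl
sumℚ≡sum (suc n) f = cong (f Fin.zero +_) (sumℚ≡sum n (λ i → f (Fin.suc i)))

sumℕ≡sum : ∀ n (f : Fin n → ℕ) → sumℕ n f ≡ ℕΣ.sum f
sumℕ≡sum zero    f = refl
sumℕ≡sum (suc n) f = cong (f Fin.zero ℕ.+_) (sumℕ≡sum n (λ i → f (Fin.suc i)))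

sumℚ-cong : ∀ n {f g : Fin n → ℚ} → (∀ i → f i ≡ g i) → sumℚ n f ≡ sumℚ n g
sumℚ-cong n {f} {g} f≗g = trans (sumℚ≡sum n f) (trans (ℚΣ.sum-cong-≗ f≗g) (sym (sumℚ≡sum n g)))

sumℚ-*ʳ : ∀ n (f : Fin n → ℚ) x → sumℚ n (λ i → f i * x) ≡ sumℚ n f * x
sumℚ-*ʳ n f x = trans (sumℚ≡sum n _) (trans (sym (ℚΣ.*-distribʳ-sum x f)) (cong (_* x) (sym (sumℚ≡sum n f))))

sumℚ-δ : ∀ n (h : Fin n → ℚ) p → (∀ s → s ≢ p → h s ≡ 0ℚ) → sumℚ n h ≡ h p
sumℚ-δ n h p vanishes = trans (sumℚ≡sum n h) (sum-δ ℚP.+-0-commutativeMonoid h p vanishes)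

sumℚ-*-distrib-− : ∀ n (q c : Fin n → ℚ) x → sumℚ n (λ i → q i * (x - c i)) ≡ x * sumℚ n q - sumℚ n (λ i → q i * c i)
sumℚ-*-distrib-− n q c x = begin
    sumℚ n (λ i → q i * (x - c i))
      ≡⟨ trans (sumℚ-cong n (λ i → regroup (q i) (c i))) (sumℚ≡sum n _) ⟩
    ℚΣ.sum (λ i → x * q i + (- 1ℚ) * (q i * c i))
      ≡⟨ ℚΣ.∑-distrib-+ (λ i → x * q i) (λ i → (- 1ℚ) * (q i * c i)) ⟩
    ℚΣ.sum (λ i → x * q i) + ℚΣ.sum (λ i → (- 1ℚ) * (q i * c i))
      ≡⟨ sym (cong₂ _+_ (ℚΣ.*-distribˡ-sum x q) (ℚΣ.*-distribˡ-sum (- 1ℚ) (λ i → q i * c i))) ⟩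
    x * ℚΣ.sum q + (- 1ℚ) * ℚΣ.sum (λ i → q i * c i)
      ≡⟨ sym (cong₂ (λ s t → x * s + (- 1ℚ) * t) (sumℚ≡sum n q) (sumℚ≡sum n _)) ⟩
    x * sumℚ n q + (- 1ℚ) * sumℚ n (λ i → q i * c i)
      ≡⟨ regroup′ x (sumℚ n q) (sumℚ n (λ i → q i * c i)) ⟩
    x * sumℚ n q - sumℚ n (λ i → q i * c i) ∎
  where
  open ≡-Reasoning
  open Data.Rational.Solver.+-*-Solver
  regroup : ∀ a b → a * (x - b) ≡ x * a + (- 1ℚ) * (a * b)
  regroup a b = solve 3 (λ x a b → a :* (x :- b) := x :* a :+ con (- 1ℚ) :* (a :* b)) refl x a b
  regroup′ : ∀ a b c → a * b + (- 1ℚ) * c ≡ a * b - c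
  regroup′ = solve 3 (λ a b c → a :* b :+ con (- 1ℚ) :* c := a :* b :- c) refl

sumℕ-cong : ∀ n {f g : Fin n → ℕ} → (∀ i → f i ≡ g i) → sumℕ n f ≡ sumℕ n g
sumℕ-cong n {f} {g} f≗g = trans (sumℕ≡sum n f) (trans (ℕΣ.sum-cong-≗ f≗g) (sym (sumℕ≡sum n g)))

sumℕ-const : ∀ n c → sumℕ n (λ _ → c) ≡ n ℕ.* c
sumℕ-const zero    c = refl
sumℕ-const (suc n) c = cong (c ℕ.+_) (sumℕ-const n c)

sumℕ-*ˡ : ∀ n (f : Fin n → ℕ) c → sumℕ n (λ i → c ℕ.* f i) ≡ c ℕ.* sumℕ n f
sumℕ-*ˡ n f c = trans (sumℕ≡sum n _) (trans (sym (ℕΣ.*-distribˡ-sum c f)) (cong (c ℕ.*_) (sym (sumℕ≡sum n f))))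

sumℕ-comm : ∀ m n (f : Fin m → Fin n → ℕ) → sumℕ m (λ i → sumℕ n (f i)) ≡ sumℕ n (λ j → sumℕ m (λ i → f i j))
sumℕ-comm m n f = begin
    sumℕ m (λ i → sumℕ n (f i))             ≡⟨ trans (sumℕ-cong m (λ i → sumℕ≡sum n (f i))) (sumℕ≡sum m _) ⟩
    ℕΣ.sum (λ i → ℕΣ.sum (f i))             ≡⟨ ℕΣ.∑-comm f ⟩
    ℕΣ.sum (λ j → ℕΣ.sum (λ i → f i j))     ≡⟨ sym (trans (sumℕ-cong n (λ j → sumℕ≡sum m _)) (sumℕ≡sum n _)) ⟩
    sumℕ n (λ j → sumℕ m (λ i → f i j))     ∎
  where open ≡-Reasoning

sumℕ-permute : ∀ n (f : Fin n → ℕ) (π : Perm.Permutation′ n) → sumℕ n f ≡ sumℕ n (λ i → f (π Perm.⟨$⟩ʳ i))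
sumℕ-permute n f π = trans (sumℕ≡sum n f) (trans (ℕΣ.∑-permute f π) (sym (sumℕ≡sum n _)))

count-unique : ∀ {n} (p : Fin n → Bool) j₀ → p j₀ ≡ true → (∀ j → p j ≡ true → j ≡ j₀) → count p ≡ 1
count-unique {n} p j₀ pj₀ unique = begin
    count p                 ≡⟨ sumℕ≡sum n _ ⟩
    ℕΣ.sum (λ j → indicator (p j)) ≡⟨ sum-δ ℕP.+-0-commutativeMonoid _ j₀ vanishes ⟩
    indicator (p j₀)        ≡⟨ cong indicator pj₀ ⟩
    1                       ∎
  where
  open ≡-Reasoning
  vanishes : ∀ j → j ≢ j₀ → indicator (p j) ≡ 0
  vanishes j j≢j₀ with p j in pj
  ... | true  = contradiction (unique j pj) j≢j₀
  ... | false = refl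

-- Iterates of a periodic map

iter-+ : ∀ {A : Set} (φ : A → A) m n x → iter (m ℕ.+ n) φ x ≡ iter m φ (iter n φ x)
iter-+ φ zero    n x = refl
iter-+ φ (suc m) n x = cong φ (iter-+ φ m n x)

module Periodic {A : Set} (φ : A → A) (k : ℕ) .{{_ : NonZero k}} (period : ∀ x → iter k φ x ≡ x) where

  iter-*k : ∀ q x → iter (q ℕ.* k) φ x ≡ x
  iter-*k zero    x = refl
  iter-*k (suc q) x = trans (iter-+ φ k (q ℕ.* k) x) (trans (cong (iter k φ) (iter-*k q x)) (period x))

  iter-% : ∀ m x → iter (m % k) φ x ≡ iter m φ x
  iter-% m x = begin
    iter (m % k) φ x                              ≡⟨ cong (iter (m % k) φ) (sym (iter-*k (m / k) x)) ⟩
    iter (m % k) φ (iter (m / k ℕ.* k) φ x)      ≡⟨ sym (iter-+ φ (m % k) (m / k ℕ.* k) x) ⟩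
    iter (m % k ℕ.+ m / k ℕ.* k) φ x              ≡⟨ cong (λ e → iter e φ x) (sym (m≡m%n+[m/n]*n m k)) ⟩
    iter m φ x                                    ∎
    where open ≡-Reasoning

  iter-inverseˡ : ∀ j → j ≤ k → ∀ x → iter (k ∸ j) φ (iter j φ x) ≡ x
  iter-inverseˡ j j≤k x =
    trans (sym (iter-+ φ (k ∸ j) j x)) (trans (cong (λ e → iter e φ x) (ℕP.m∸n+n≡m j≤k)) (period x))

  iter-inverseʳ : ∀ j → j ≤ k → ∀ x → iter j φ (iter (k ∸ j) φ x) ≡ x
  iter-inverseʳ j j≤k x =
    trans (sym (iter-+ φ j (k ∸ j) x)) (trans (cong (λ e → iter e φ x) (ℕP.m+[n∸m]≡n j≤k)) (period x))

  iter-injective : ∀ j → j ≤ k → ∀ {x y} → iter j φ x ≡ iter j φ y → x ≡ y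
  iter-injective j j≤k {x} {y} eq =
    trans (sym (iter-inverseˡ j j≤k x)) (trans (cong (iter (k ∸ j) φ) eq) (iter-inverseˡ j j≤k y))

-- The translates of a base

module Translates {k : ℕ} .{{_ : NonZero k}} {G : Graph} (f : KSymAut k G) (β : Base f) where
  open Periodic (φ f) k (period f)

  translate : Fin k → Fin (N G) → Bool
  translate j a = ⌊ any? (λ b → (B β b ≟ᵇ true) ×-dec (iter (toℕ j) (φ f) b ≟ a)) ⌋

  translate⁺ : ∀ j {a} b → B β b ≡ true → iter (toℕ j) (φ f) b ≡ a → translate j a ≡ true
  translate⁺ j b Bb φʲb≡a = ⇒isYes (any? _) (b , Bb , φʲb≡a)

  translate⁻ : ∀ j {a} → translate j a ≡ true → ∃ λ b → B β b ≡ true × iter (toℕ j) (φ f) b ≡ a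
  translate⁻ j a∈ = isYes⇒ (any? _) a∈

  -- Removing b' from B keeps it covering, via b = φ^d(b'); minimality forbids this.
  base-orbit-disjoint : ∀ {b b' d} → B β b ≡ true → B β b' ≡ true → 0 < d → d < k → iter d (φ f) b' ≢ b
  base-orbit-disjoint {b} {b'} {d} Bb Bb' 0<d d<k φᵈb'≡b =
    contradiction (minimal β S S⊆B S-covers b' Bb') S-excludes-b'
    where
    S : Fin (N G) → Bool
    S x = not ⌊ x ≟ b' ⌋ ∧ B β x

    S⊆B : ∀ x → S x ≡ true → B β x ≡ true
    S⊆B x Sx with x ≟ b'
    ... | no _ = Sx

    S-excludes-b' : S b' ≢ true
    S-excludes-b' Sb' with b' ≟ b'
    ... | no b'≢b' = b'≢b' refl

    S-intro : ∀ {x} → B β x ≡ true → x ≢ b' → S x ≡ true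
    S-intro {x} Bx x≢b' with x ≟ b'
    ... | yes x≡b' = contradiction x≡b' x≢b'
    ... | no _     = Bx

    b≢b' : b ≢ b'
    b≢b' b≡b' = free f d 0<d d<k b' (trans φᵈb'≡b b≡b')

    φᵏ⁻ᵈb≡b' : iter (k ∸ d) (φ f) b ≡ b'
    φᵏ⁻ᵈb≡b' = trans (cong (iter (k ∸ d) (φ f)) (sym φᵈb'≡b)) (iter-inverseˡ d (ℕP.<⇒≤ d<k) b')

    S-covers : Covers f S
    S-covers v with covers β v
    ... | i , i<k , c , Bc , φⁱc≡v with c ≟ b'
    ...   | no c≢b'  = i , i<k , c , S-intro Bc c≢b' , φⁱc≡v
    ...   | yes refl = (i ℕ.+ (k ∸ d)) % k , m%n<n _ k , b , S-intro Bb b≢b' , (begin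
      iter ((i ℕ.+ (k ∸ d)) % k) (φ f) b   ≡⟨ iter-% (i ℕ.+ (k ∸ d)) b ⟩
      iter (i ℕ.+ (k ∸ d)) (φ f) b         ≡⟨ iter-+ (φ f) i (k ∸ d) b ⟩
      iter i (φ f) (iter (k ∸ d) (φ f) b)  ≡⟨ cong (iter i (φ f)) φᵏ⁻ᵈb≡b' ⟩
      iter i (φ f) c                       ≡⟨ φⁱc≡v ⟩
      v                                    ∎)
      where open ≡-Reasoning

  base-orbit-<-disjoint : ∀ {b b' i j} → B β b ≡ true → B β b' ≡ true → i < j → j < k →
                          iter i (φ f) b ≢ iter j (φ f) b'
  base-orbit-<-disjoint {b} {b'} {i} {j} Bb Bb' i<j j<k φⁱb≡φʲb' =
    base-orbit-disjoint Bb Bb' (ℕP.m<n⇒0<n∸m i<j) (ℕP.≤-<-trans (ℕP.m∸n≤m j i) j<k) (sym φʲ⁻ⁱb'≡b)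
    where
    φʲ⁻ⁱb'≡b : b ≡ iter (j ∸ i) (φ f) b'
    φʲ⁻ⁱb'≡b = iter-injective i (ℕP.<⇒≤ (ℕP.<-trans i<j j<k)) (begin
      iter i (φ f) b                        ≡⟨ φⁱb≡φʲb' ⟩
      iter j (φ f) b'                       ≡⟨ cong (λ e → iter e (φ f) b') (sym (ℕP.m+[n∸m]≡n (ℕP.<⇒≤ i<j))) ⟩
      iter (i ℕ.+ (j ∸ i)) (φ f) b'         ≡⟨ iter-+ (φ f) i (j ∸ i) b' ⟩
      iter i (φ f) (iter (j ∸ i) (φ f) b')  ∎)
      where open ≡-Reasoning

  base-orbit-unique : ∀ {b b' i j} → B β b ≡ true → B β b' ≡ true → i < k → j < k →
                      iter i (φ f) b ≡ iter j (φ f) b' → i ≡ j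
  base-orbit-unique {i = i} {j} Bb Bb' i<k j<k eq with ℕP.<-cmp i j
  ... | tri< i<j _ _ = contradiction eq (base-orbit-<-disjoint Bb Bb' i<j j<k)
  ... | tri≈ _ i≡j _ = i≡j
  ... | tri> _ _ j<i = contradiction (sym eq) (base-orbit-<-disjoint Bb' Bb j<i i<k)

  translateIndex : Fin (N G) → Fin k
  translateIndex a = fromℕ< (proj₁ (proj₂ (covers β a)))

  translate-translateIndex : ∀ a → translate (translateIndex a) a ≡ true
  translate-translateIndex a with covers β a
  ... | i , i<k , b , Bb , φⁱb≡a =
    translate⁺ (fromℕ< i<k) b Bb (trans (cong (λ e → iter e (φ f) b) (toℕ-fromℕ< i<k)) φⁱb≡a)

  translate⇒translateIndex : ∀ j a → translate j a ≡ true → j ≡ translateIndex a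
  translate⇒translateIndex j a a∈ with covers β a | translate⁻ j a∈
  ... | i , i<k , b , Bb , φⁱb≡a | b' , Bb' , φʲb'≡a = toℕ-injective
    (trans (base-orbit-unique Bb' Bb (toℕ<n j) i<k (trans φʲb'≡a (sym φⁱb≡a))) (sym (toℕ-fromℕ< i<k)))

  translate-iter : ∀ j b → translate j (iter (toℕ j) (φ f) b) ≡ B β b
  translate-iter j b = isYes-≡ (any? _)
    (λ { (b' , Bb' , φʲb'≡φʲb) → subst (λ x → B β x ≡ true) (iter-injective (toℕ j) (ℕP.<⇒≤ (toℕ<n j)) φʲb'≡φʲb) Bb' })
    (λ Bb → b , Bb , refl)

  count-translate : ∀ j → count (translate j) ≡ count (B β)
  count-translate j = trans (sumℕ-permute (N G) _ φʲ) (sumℕ-cong (N G) (λ b → cong indicator (translate-iter j b)))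
    where
    j≤k = ℕP.<⇒≤ (toℕ<n j)
    φʲ : Perm.Permutation′ (N G)
    φʲ = Perm.permutation (iter (toℕ j) (φ f)) (iter (k ∸ toℕ j) (φ f)) (iter-inverseʳ (toℕ j) j≤k) (iter-inverseˡ (toℕ j) j≤k)

  N≡k*count-base : N G ≡ k ℕ.* count (B β)
  N≡k*count-base = begin
    N G                                                      ≡⟨ sym (ℕP.*-identityʳ (N G)) ⟩
    N G ℕ.* 1                                                ≡⟨ sym (sumℕ-const (N G) 1) ⟩
    sumℕ (N G) (λ _ → 1)                                     ≡⟨ sumℕ-cong (N G) (λ a → sym (count-translates∋ a)) ⟩
    sumℕ (N G) (λ a → sumℕ k (λ j → indicator (translate j a)))  ≡⟨ sumℕ-comm (N G) k _ ⟩
    sumℕ k (λ j → count (translate j))                        ≡⟨ sumℕ-cong k count-translate ⟩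
    sumℕ k (λ _ → count (B β))                               ≡⟨ sumℕ-const k _ ⟩
    k ℕ.* count (B β)                                        ∎
    where
    open ≡-Reasoning
    count-translates∋ : ∀ a → count (λ j → translate j a) ≡ 1
    count-translates∋ a = count-unique _ (translateIndex a) (translate-translateIndex a) (λ j → translate⇒translateIndex j a)

-- The join

any?-at-unique : ∀ {n} (p q : Fin n → Bool) j₀ → p j₀ ≡ true → (∀ j → p j ≡ true → j ≡ j₀) →
                 ⌊ any? (λ j → (p j ≟ᵇ true) ×-dec (q j ≟ᵇ true)) ⌋ ≡ q j₀
any?-at-unique p q j₀ pj₀ unique = isYes-≡ (any? _)
  (λ { (j , pj , qj) → subst (λ j → q j ≡ true) (unique j pj) qj })
  (λ qj₀ → j₀ , pj₀ , qj₀)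

vertex : (G : Graph) → Fin (N G)
vertex G = fromℕ< (nonempty G)

module JoinLaplacian (k : ℕ) .{{_ : NonZero k}} (l : ℕ) (G : Fin l → Graph)
                     (f : ∀ i → KSymAut k (G i)) (β : ∀ i → Base (f i)) where
  open Join G f β
  module T (i : Fin l) = Translates (f i) (β i)

  baseSize : Fin l → ℚ
  baseSize i = ℕtoℚ (count (B (β i)))

  joinAdj-across : ∀ {i i'} → i ≢ i' → ∀ a a' → joinAdj (i , a) (i' , a') ≡ T.translate i' (T.translateIndex i a) a'
  joinAdj-across {i} {i'} i≢i' a a' with i ≟ i'
  ... | yes i≡i' = contradiction i≡i' i≢i'
  ... | no _     = any?-at-unique _ _ (T.translateIndex i a) (T.translate-translateIndex i a) (λ j → T.translate⇒translateIndex i j a)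

  block-sum : ∀ (c : Fin l → ℚ) i a i' → Dec (i ≡ i') →
              sumℚ (N (G i')) (λ a' → (if joinAdj (i , a) (i' , a') then 1ℚ else 0ℚ) * (c i - c i')) ≡ baseSize i' * (c i - c i')
  block-sum c i a .i (yes refl) = begin
    sumℚ (N (G i)) (λ a' → e a' * (c i - c i))  ≡⟨ sumℚ-*ʳ (N (G i)) e (c i - c i) ⟩
    sumℚ (N (G i)) e * (c i - c i)              ≡⟨ cong (sumℚ (N (G i)) e *_) (ℚP.+-inverseʳ (c i)) ⟩
    sumℚ (N (G i)) e * 0ℚ                       ≡⟨ ℚP.*-zeroʳ (sumℚ (N (G i)) e) ⟩
    0ℚ                                          ≡⟨ sym (ℚP.*-zeroʳ (baseSize i)) ⟩
    baseSize i * 0ℚ                             ≡⟨ cong (baseSize i *_) (sym (ℚP.+-inverseʳ (c i))) ⟩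
    baseSize i * (c i - c i)                    ∎
    where
    open ≡-Reasoning
    e : Fin (N (G i)) → ℚ
    e a' = if joinAdj (i , a) (i , a') then 1ℚ else 0ℚ
  block-sum c i a i' (no i≢i') = begin
    sumℚ (N (G i')) (λ a' → (if joinAdj (i , a) (i' , a') then 1ℚ else 0ℚ) * (c i - c i'))
      ≡⟨ sumℚ-cong (N (G i')) (λ a' → cong (_* (c i - c i'))
           (trans (cong (λ e → if e then 1ℚ else 0ℚ) (joinAdj-across i≢i' a a')) (ℕtoℚ-indicator _))) ⟩
    sumℚ (N (G i')) (λ a' → ℕtoℚ (indicator (T.translate i' j a')) * (c i - c i'))
      ≡⟨ sumℚ-*ʳ (N (G i')) _ (c i - c i') ⟩
    sumℚ (N (G i')) (λ a' → ℕtoℚ (indicator (T.translate i' j a'))) * (c i - c i')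
      ≡⟨ cong (_* (c i - c i')) (sym (ℕtoℚ-sumℕ (N (G i')) _)) ⟩
    ℕtoℚ (count (T.translate i' j)) * (c i - c i')
      ≡⟨ cong (λ e → ℕtoℚ e * (c i - c i')) (T.count-translate i' j) ⟩
    baseSize i' * (c i - c i') ∎
    where
    open ≡-Reasoning
    j = T.translateIndex i a

  size/k≡sum-count-base : size / k ≡ sumℕ l (λ i → count (B (β i)))
  size/k≡sum-count-base = begin
    size / k                                       ≡⟨ cong (_/ k) (sumℕ-cong l T.N≡k*count-base) ⟩
    sumℕ l (λ i → k ℕ.* count (B (β i))) / k       ≡⟨ cong (_/ k) (trans (sumℕ-*ˡ l _ k) (ℕP.*-comm k _)) ⟩
    sumℕ l (λ i → count (B (β i))) ℕ.* k / k       ≡⟨ m*n/n≡m _ k ⟩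
    sumℕ l (λ i → count (B (β i)))                 ∎
    where open ≡-Reasoning

  blockwise-eigenvector : ∀ (c : Fin l → ℚ) → sumℚ l (λ i → baseSize i * c i) ≡ 0ℚ →
    ∀ v → laplacian sumV joinAdj (λ u → c (proj₁ u)) v ≡ ℕtoℚ (size / k) * c (proj₁ v)
  blockwise-eigenvector c orthogonal (i , a) = begin
    sumℚ l (λ i' → sumℚ (N (G i')) (λ a' → (if joinAdj (i , a) (i' , a') then 1ℚ else 0ℚ) * (c i - c i')))
      ≡⟨ sumℚ-cong l (λ i' → block-sum c i a i' (i ≟ i')) ⟩
    sumℚ l (λ i' → baseSize i' * (c i - c i'))
      ≡⟨ sumℚ-*-distrib-− l baseSize c (c i) ⟩
    c i * sumℚ l baseSize - sumℚ l (λ i' → baseSize i' * c i')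
      ≡⟨ cong₂ (λ s t → c i * s - t) (sym (trans (cong ℕtoℚ size/k≡sum-count-base) (ℕtoℚ-sumℕ l _))) orthogonal ⟩
    c i * ℕtoℚ (size / k) - 0ℚ
      ≡⟨ solve 2 (λ x n → x :* n :- con 0ℚ := n :* x) refl (c i) (ℕtoℚ (size / k)) ⟩
    ℕtoℚ (size / k) * c i ∎
    where
    open ≡-Reasoning
    open Data.Rational.Solver.+-*-Solver

  baseSize≢0 : ∀ i → baseSize i ≢ 0ℚ
  baseSize≢0 i with count (B (β i)) in eq
  ... | suc m = ℕtoℚ-suc≢0 m
  ... | zero  = λ _ → ℕP.<-irrefl (sym N≡0) (nonempty (G i))
    where
    N≡0 : N (G i) ≡ 0
    N≡0 = trans (T.N≡k*count-base i) (trans (cong (k ℕ.*_) eq) (ℕP.*-zeroʳ k))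

-- Hyperplanes

module Hyperplane (m : ℕ) (q : Fin (suc m) → ℚ) where

  kernelBasis : Fin m → Fin (suc m) → ℚ
  kernelBasis t Fin.zero    = - q (Fin.suc t)
  kernelBasis t (Fin.suc s) = if ⌊ s ≟ t ⌋ then q Fin.zero else 0ℚ

  kernelBasis-diagonal : ∀ t → kernelBasis t (Fin.suc t) ≡ q Fin.zero
  kernelBasis-diagonal t with t ≟ t
  ... | yes _   = refl
  ... | no t≢t  = contradiction refl t≢t

  kernelBasis-offDiagonal : ∀ t s → s ≢ t → kernelBasis t (Fin.suc s) ≡ 0ℚ
  kernelBasis-offDiagonal t s s≢t with s ≟ t
  ... | yes s≡t = contradiction s≡t s≢t
  ... | no _    = refl

  kernelBasis-orthogonal : ∀ t → sumℚ (suc m) (λ i → q i * kernelBasis t i) ≡ 0ℚ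
  kernelBasis-orthogonal t = begin
    q Fin.zero * - q (Fin.suc t) + sumℚ m (λ s → q (Fin.suc s) * kernelBasis t (Fin.suc s))
      ≡⟨ cong (q Fin.zero * - q (Fin.suc t) +_) (sumℚ-δ m _ t (λ s s≢t →
           trans (cong (q (Fin.suc s) *_) (kernelBasis-offDiagonal t s s≢t)) (ℚP.*-zeroʳ (q (Fin.suc s))))) ⟩
    q Fin.zero * - q (Fin.suc t) + q (Fin.suc t) * kernelBasis t (Fin.suc t)
      ≡⟨ cong (λ e → q Fin.zero * - q (Fin.suc t) + q (Fin.suc t) * e) (kernelBasis-diagonal t) ⟩
    q Fin.zero * - q (Fin.suc t) + q (Fin.suc t) * q Fin.zero
      ≡⟨ solve 2 (λ x y → x :* (:- y) :+ y :* x := con 0ℚ) refl (q Fin.zero) (q (Fin.suc t)) ⟩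
    0ℚ ∎
    where
    open ≡-Reasoning
    open Data.Rational.Solver.+-*-Solver

  kernelBasis-independent : q Fin.zero ≢ 0ℚ → ∀ (c : Fin m → ℚ) →
    (∀ i → sumℚ m (λ t → c t * kernelBasis t i) ≡ 0ℚ) → ∀ t → c t ≡ 0ℚ
  kernelBasis-independent q₀≢0 c combination≡0 s = x*q≡0⇒x≡0 (c s) (q Fin.zero) q₀≢0 (begin
    c s * q Fin.zero                                  ≡⟨ cong (c s *_) (sym (kernelBasis-diagonal s)) ⟩
    c s * kernelBasis s (Fin.suc s)                   ≡⟨ sym (sumℚ-δ m _ s (λ t t≢s →
                                                           trans (cong (c t *_) (kernelBasis-offDiagonal t s (λ s≡t → t≢s (sym s≡t)))) (ℚP.*-zeroʳ (c t)))) ⟩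
    sumℚ m (λ t → c t * kernelBasis t (Fin.suc s))    ≡⟨ combination≡0 (Fin.suc s) ⟩
    0ℚ                                                ∎)
    where open ≡-Reasoning

theorem4p2 : (k : ℕ) → .{{_ : NonZero k}} → (l : ℕ) → (G : Fin l → Graph)
    → (f : ∀ i → KSymAut k (G i)) → (β : ∀ i → Base (f i))
    → MultAtLeast (Join.sumV G f β) (Join.joinAdj G f β)
        (ℕtoℚ (Join.size G f β / k)) (l ∸ 1)
theorem4p2 k zero    G f β = (λ ()) , (λ ()) , (λ _ _ ())
theorem4p2 k (suc m) G f β = w , eigen , independent
  where
  open JoinLaplacian k (suc m) G f β
  open Hyperplane m baseSize

  w : Fin m → Join.V G f β → ℚ
  w t (i , _) = kernelBasis t i

  eigen : ∀ t v → laplacian (Join.sumV G f β) (Join.joinAdj G f β) (w t) v ≡ ℕtoℚ (Join.size G f β / k) * w t v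
  eigen t = blockwise-eigenvector (kernelBasis t) (kernelBasis-orthogonal t)

  independent : ∀ c → (∀ v → sumℚ m (λ t → c t * w t v) ≡ 0ℚ) → ∀ t → c t ≡ 0ℚ
  independent c combination≡0 = kernelBasis-independent (baseSize≢0 Fin.zero) c (λ i → combination≡0 (i , vertex (G i)))
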